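{- Let $F_1$ and $F_2$ be finite fields with $|F_1^*|=m$ and $|F_2^*|=n$, where $F_i^*=F_i\setminus\{0\}$. Then (i) $\alpha(\Gamma(F_1\times F_2))=\max\{m,n\}$; (ii) $\alpha(\Gamma(F_1\times \mathbb{Z}_4))=\max\{2m,3\}$.
   Context: For a commutative ring $R$ with identity $1\neq 0$, the zero-divisor graph $\Gamma(R)$ is the simple undirected graph whose vertices are the nonzero zero-divisors of $R$, two distinct vertices $x,y$ being adjacent iff $xy=0$. For a graph $G$, an independent set is a set of vertices no two of which are adjacent, and the independence number $\alpha(G)$ is the maximum cardinality of an independent set. $\mathbb{Z}_4$ denotes the integers modulo $4$. -}

module Defs where

open import Level using (Level; _⊔_)
open import Data.Nat using (ℕ; _≤_)
open import Data.Product using (Σ; ∃; _×_; _,_)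
open import Data.List using (List; length)
open import Data.List.Relation.Unary.All using (All)
open import Data.List.Relation.Unary.Any using (Any)
open import Data.List.Relation.Unary.AllPairs using (AllPairs)
open import Relation.Nullary using (¬_)
open import Relation.Binary.PropositionalEquality using (_≡_; refl; cong; cong₂; isEquivalence)
open import Algebra.Bundles using (CommutativeRing)
open import Algebra.Structures using (IsCommutativeRing)

module _ {c ℓ : Level} (R : CommutativeRing c ℓ) where
  open CommutativeRing R

  IsVertex : Carrier → Set (c ⊔ ℓ)
  IsVertex x = ¬ (x ≈ 0#) × ∃ λ y → ¬ (y ≈ 0#) × (x * y) ≈ 0#

  Adjacent : Carrier → Carrier → Set ℓ
  Adjacent x y = ¬ (x ≈ y) × (x * y) ≈ 0#

  IsIndependentSet : List Carrier → Set (c ⊔ ℓ)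
  IsIndependentSet xs =
    All IsVertex xs × AllPairs (λ x y → ¬ (x ≈ y) × ¬ (Adjacent x y)) xs

  IndependenceNumber : ℕ → Set (c ⊔ ℓ)
  IndependenceNumber k =
    (Σ (List Carrier) λ xs → IsIndependentSet xs × length xs ≡ k) ×
    (∀ xs → IsIndependentSet xs → length xs ≤ k)

  IsField : Set (c ⊔ ℓ)
  IsField = ¬ (1# ≈ 0#) × (∀ x → ¬ (x ≈ 0#) → ∃ λ y → (x * y) ≈ 1#)

  NonzeroCard : ℕ → Set (c ⊔ ℓ)
  NonzeroCard m = Σ (List Carrier) λ xs →
    AllPairs (λ x y → ¬ (x ≈ y)) xs ×
    All (λ x → ¬ (x ≈ 0#)) xs ×
    (∀ x → ¬ (x ≈ 0#) → Any (x ≈_) xs) ×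
    length xs ≡ m

data Z4 : Set where
  z0 z1 z2 z3 : Z4

infixl 6 _+₄_
infixl 7 _*₄_

_+₄_ : Z4 → Z4 → Z4
_*₄_ : Z4 → Z4 → Z4
-₄_ : Z4 → Z4

z0 +₄ z0 = z0
z0 +₄ z1 = z1
z0 +₄ z2 = z2
z0 +₄ z3 = z3
z1 +₄ z0 = z1
z1 +₄ z1 = z2
z1 +₄ z2 = z3
z1 +₄ z3 = z0
z2 +₄ z0 = z2
z2 +₄ z1 = z3
z2 +₄ z2 = z0
z2 +₄ z3 = z1
z3 +₄ z0 = z3
z3 +₄ z1 = z0
z3 +₄ z2 = z1
z3 +₄ z3 = z2
z0 *₄ z0 = z0
z0 *₄ z1 = z0
z0 *₄ z2 = z0
z0 *₄ z3 = z0
z1 *₄ z0 = z0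
z1 *₄ z1 = z1
z1 *₄ z2 = z2
z1 *₄ z3 = z3
z2 *₄ z0 = z0
z2 *₄ z1 = z2
z2 *₄ z2 = z0
z2 *₄ z3 = z2
z3 *₄ z0 = z0
z3 *₄ z1 = z3
z3 *₄ z2 = z2
z3 *₄ z3 = z1
-₄ z0 = z0
-₄ z1 = z3
-₄ z2 = z2
-₄ z3 = z1

+₄-assoc : ∀ a b c → (a +₄ b) +₄ c ≡ a +₄ (b +₄ c)
+₄-assoc z0 z0 z0 = refl
+₄-assoc z0 z0 z1 = refl
+₄-assoc z0 z0 z2 = refl
+₄-assoc z0 z0 z3 = refl
+₄-assoc z0 z1 z0 = refl
+₄-assoc z0 z1 z1 = refl
+₄-assoc z0 z1 z2 = refl
+₄-assoc z0 z1 z3 = refl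
+₄-assoc z0 z2 z0 = refl
+₄-assoc z0 z2 z1 = refl
+₄-assoc z0 z2 z2 = refl
+₄-assoc z0 z2 z3 = refl
+₄-assoc z0 z3 z0 = refl
+₄-assoc z0 z3 z1 = refl
+₄-assoc z0 z3 z2 = refl
+₄-assoc z0 z3 z3 = refl
+₄-assoc z1 z0 z0 = refl
+₄-assoc z1 z0 z1 = refl
+₄-assoc z1 z0 z2 = refl
+₄-assoc z1 z0 z3 = refl
+₄-assoc z1 z1 z0 = refl
+₄-assoc z1 z1 z1 = refl
+₄-assoc z1 z1 z2 = refl
+₄-assoc z1 z1 z3 = refl
+₄-assoc z1 z2 z0 = refl
+₄-assoc z1 z2 z1 = refl
+₄-assoc z1 z2 z2 = refl
+₄-assoc z1 z2 z3 = refl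
+₄-assoc z1 z3 z0 = refl
+₄-assoc z1 z3 z1 = refl
+₄-assoc z1 z3 z2 = refl
+₄-assoc z1 z3 z3 = refl
+₄-assoc z2 z0 z0 = refl
+₄-assoc z2 z0 z1 = refl
+₄-assoc z2 z0 z2 = refl
+₄-assoc z2 z0 z3 = refl
+₄-assoc z2 z1 z0 = refl
+₄-assoc z2 z1 z1 = refl
+₄-assoc z2 z1 z2 = refl
+₄-assoc z2 z1 z3 = refl
+₄-assoc z2 z2 z0 = refl
+₄-assoc z2 z2 z1 = refl
+₄-assoc z2 z2 z2 = refl
+₄-assoc z2 z2 z3 = refl
+₄-assoc z2 z3 z0 = refl
+₄-assoc z2 z3 z1 = refl
+₄-assoc z2 z3 z2 = refl
+₄-assoc z2 z3 z3 = refl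
+₄-assoc z3 z0 z0 = refl
+₄-assoc z3 z0 z1 = refl
+₄-assoc z3 z0 z2 = refl
+₄-assoc z3 z0 z3 = refl
+₄-assoc z3 z1 z0 = refl
+₄-assoc z3 z1 z1 = refl
+₄-assoc z3 z1 z2 = refl
+₄-assoc z3 z1 z3 = refl
+₄-assoc z3 z2 z0 = refl
+₄-assoc z3 z2 z1 = refl
+₄-assoc z3 z2 z2 = refl
+₄-assoc z3 z2 z3 = refl
+₄-assoc z3 z3 z0 = refl
+₄-assoc z3 z3 z1 = refl
+₄-assoc z3 z3 z2 = refl
+₄-assoc z3 z3 z3 = refl

*₄-assoc : ∀ a b c → (a *₄ b) *₄ c ≡ a *₄ (b *₄ c)
*₄-assoc z0 z0 z0 = refl
*₄-assoc z0 z0 z1 = refl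
*₄-assoc z0 z0 z2 = refl
*₄-assoc z0 z0 z3 = refl
*₄-assoc z0 z1 z0 = refl
*₄-assoc z0 z1 z1 = refl
*₄-assoc z0 z1 z2 = refl
*₄-assoc z0 z1 z3 = refl
*₄-assoc z0 z2 z0 = refl
*₄-assoc z0 z2 z1 = refl
*₄-assoc z0 z2 z2 = refl
*₄-assoc z0 z2 z3 = refl
*₄-assoc z0 z3 z0 = refl
*₄-assoc z0 z3 z1 = refl
*₄-assoc z0 z3 z2 = refl
*₄-assoc z0 z3 z3 = refl
*₄-assoc z1 z0 z0 = refl
*₄-assoc z1 z0 z1 = refl
*₄-assoc z1 z0 z2 = refl
*₄-assoc z1 z0 z3 = refl
*₄-assoc z1 z1 z0 = refl
*₄-assoc z1 z1 z1 = refl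
*₄-assoc z1 z1 z2 = refl
*₄-assoc z1 z1 z3 = refl
*₄-assoc z1 z2 z0 = refl
*₄-assoc z1 z2 z1 = refl
*₄-assoc z1 z2 z2 = refl
*₄-assoc z1 z2 z3 = refl
*₄-assoc z1 z3 z0 = refl
*₄-assoc z1 z3 z1 = refl
*₄-assoc z1 z3 z2 = refl
*₄-assoc z1 z3 z3 = refl
*₄-assoc z2 z0 z0 = refl
*₄-assoc z2 z0 z1 = refl
*₄-assoc z2 z0 z2 = refl
*₄-assoc z2 z0 z3 = refl
*₄-assoc z2 z1 z0 = refl
*₄-assoc z2 z1 z1 = refl
*₄-assoc z2 z1 z2 = refl
*₄-assoc z2 z1 z3 = refl
*₄-assoc z2 z2 z0 = refl
*₄-assoc z2 z2 z1 = refl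
*₄-assoc z2 z2 z2 = refl
*₄-assoc z2 z2 z3 = refl
*₄-assoc z2 z3 z0 = refl
*₄-assoc z2 z3 z1 = refl
*₄-assoc z2 z3 z2 = refl
*₄-assoc z2 z3 z3 = refl
*₄-assoc z3 z0 z0 = refl
*₄-assoc z3 z0 z1 = refl
*₄-assoc z3 z0 z2 = refl
*₄-assoc z3 z0 z3 = refl
*₄-assoc z3 z1 z0 = refl
*₄-assoc z3 z1 z1 = refl
*₄-assoc z3 z1 z2 = refl
*₄-assoc z3 z1 z3 = refl
*₄-assoc z3 z2 z0 = refl
*₄-assoc z3 z2 z1 = refl
*₄-assoc z3 z2 z2 = refl
*₄-assoc z3 z2 z3 = refl
*₄-assoc z3 z3 z0 = refl
*₄-assoc z3 z3 z1 = refl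
*₄-assoc z3 z3 z2 = refl
*₄-assoc z3 z3 z3 = refl

distˡ : ∀ a b c → a *₄ (b +₄ c) ≡ (a *₄ b) +₄ (a *₄ c)
distˡ z0 z0 z0 = refl
distˡ z0 z0 z1 = refl
distˡ z0 z0 z2 = refl
distˡ z0 z0 z3 = refl
distˡ z0 z1 z0 = refl
distˡ z0 z1 z1 = refl
distˡ z0 z1 z2 = refl
distˡ z0 z1 z3 = refl
distˡ z0 z2 z0 = refl
distˡ z0 z2 z1 = refl
distˡ z0 z2 z2 = refl
distˡ z0 z2 z3 = refl
distˡ z0 z3 z0 = refl
distˡ z0 z3 z1 = refl
distˡ z0 z3 z2 = refl
distˡ z0 z3 z3 = refl
distˡ z1 z0 z0 = refl
distˡ z1 z0 z1 = refl
distˡ z1 z0 z2 = refl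
distˡ z1 z0 z3 = refl
distˡ z1 z1 z0 = refl
distˡ z1 z1 z1 = refl
distˡ z1 z1 z2 = refl
distˡ z1 z1 z3 = refl
distˡ z1 z2 z0 = refl
distˡ z1 z2 z1 = refl
distˡ z1 z2 z2 = refl
distˡ z1 z2 z3 = refl
distˡ z1 z3 z0 = refl
distˡ z1 z3 z1 = refl
distˡ z1 z3 z2 = refl
distˡ z1 z3 z3 = refl
distˡ z2 z0 z0 = refl
distˡ z2 z0 z1 = refl
distˡ z2 z0 z2 = refl
distˡ z2 z0 z3 = refl
distˡ z2 z1 z0 = refl
distˡ z2 z1 z1 = refl
distˡ z2 z1 z2 = refl
distˡ z2 z1 z3 = refl
distˡ z2 z2 z0 = refl
distˡ z2 z2 z1 = refl
distˡ z2 z2 z2 = refl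
distˡ z2 z2 z3 = refl
distˡ z2 z3 z0 = refl
distˡ z2 z3 z1 = refl
distˡ z2 z3 z2 = refl
distˡ z2 z3 z3 = refl
distˡ z3 z0 z0 = refl
distˡ z3 z0 z1 = refl
distˡ z3 z0 z2 = refl
distˡ z3 z0 z3 = refl
distˡ z3 z1 z0 = refl
distˡ z3 z1 z1 = refl
distˡ z3 z1 z2 = refl
distˡ z3 z1 z3 = refl
distˡ z3 z2 z0 = refl
distˡ z3 z2 z1 = refl
distˡ z3 z2 z2 = refl
distˡ z3 z2 z3 = refl
distˡ z3 z3 z0 = refl
distˡ z3 z3 z1 = refl
distˡ z3 z3 z2 = refl
distˡ z3 z3 z3 = refl

distʳ : ∀ a b c → (b +₄ c) *₄ a ≡ (b *₄ a) +₄ (c *₄ a)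
distʳ z0 z0 z0 = refl
distʳ z0 z0 z1 = refl
distʳ z0 z0 z2 = refl
distʳ z0 z0 z3 = refl
distʳ z0 z1 z0 = refl
distʳ z0 z1 z1 = refl
distʳ z0 z1 z2 = refl
distʳ z0 z1 z3 = refl
distʳ z0 z2 z0 = refl
distʳ z0 z2 z1 = refl
distʳ z0 z2 z2 = refl
distʳ z0 z2 z3 = refl
distʳ z0 z3 z0 = refl
distʳ z0 z3 z1 = refl
distʳ z0 z3 z2 = refl
distʳ z0 z3 z3 = refl
distʳ z1 z0 z0 = refl
distʳ z1 z0 z1 = refl
distʳ z1 z0 z2 = refl
distʳ z1 z0 z3 = refl
distʳ z1 z1 z0 = refl
distʳ z1 z1 z1 = refl
distʳ z1 z1 z2 = refl
distʳ z1 z1 z3 = refl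
distʳ z1 z2 z0 = refl
distʳ z1 z2 z1 = refl
distʳ z1 z2 z2 = refl
distʳ z1 z2 z3 = refl
distʳ z1 z3 z0 = refl
distʳ z1 z3 z1 = refl
distʳ z1 z3 z2 = refl
distʳ z1 z3 z3 = refl
distʳ z2 z0 z0 = refl
distʳ z2 z0 z1 = refl
distʳ z2 z0 z2 = refl
distʳ z2 z0 z3 = refl
distʳ z2 z1 z0 = refl
distʳ z2 z1 z1 = refl
distʳ z2 z1 z2 = refl
distʳ z2 z1 z3 = refl
distʳ z2 z2 z0 = refl
distʳ z2 z2 z1 = refl
distʳ z2 z2 z2 = refl
distʳ z2 z2 z3 = refl
distʳ z2 z3 z0 = refl
distʳ z2 z3 z1 = refl
distʳ z2 z3 z2 = refl
distʳ z2 z3 z3 = refl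
distʳ z3 z0 z0 = refl
distʳ z3 z0 z1 = refl
distʳ z3 z0 z2 = refl
distʳ z3 z0 z3 = refl
distʳ z3 z1 z0 = refl
distʳ z3 z1 z1 = refl
distʳ z3 z1 z2 = refl
distʳ z3 z1 z3 = refl
distʳ z3 z2 z0 = refl
distʳ z3 z2 z1 = refl
distʳ z3 z2 z2 = refl
distʳ z3 z2 z3 = refl
distʳ z3 z3 z0 = refl
distʳ z3 z3 z1 = refl
distʳ z3 z3 z2 = refl
distʳ z3 z3 z3 = refl

+₄-comm : ∀ a b → a +₄ b ≡ b +₄ a
+₄-comm z0 z0 = refl
+₄-comm z0 z1 = refl
+₄-comm z0 z2 = refl
+₄-comm z0 z3 = refl
+₄-comm z1 z0 = refl
+₄-comm z1 z1 = refl
+₄-comm z1 z2 = refl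
+₄-comm z1 z3 = refl
+₄-comm z2 z0 = refl
+₄-comm z2 z1 = refl
+₄-comm z2 z2 = refl
+₄-comm z2 z3 = refl
+₄-comm z3 z0 = refl
+₄-comm z3 z1 = refl
+₄-comm z3 z2 = refl
+₄-comm z3 z3 = refl

*₄-comm : ∀ a b → a *₄ b ≡ b *₄ a
*₄-comm z0 z0 = refl
*₄-comm z0 z1 = refl
*₄-comm z0 z2 = refl
*₄-comm z0 z3 = refl
*₄-comm z1 z0 = refl
*₄-comm z1 z1 = refl
*₄-comm z1 z2 = refl
*₄-comm z1 z3 = refl
*₄-comm z2 z0 = refl
*₄-comm z2 z1 = refl
*₄-comm z2 z2 = refl
*₄-comm z2 z3 = refl
*₄-comm z3 z0 = refl
*₄-comm z3 z1 = refl
*₄-comm z3 z2 = refl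
*₄-comm z3 z3 = refl

+₄-idˡ : ∀ a → z0 +₄ a ≡ a
+₄-idˡ z0 = refl
+₄-idˡ z1 = refl
+₄-idˡ z2 = refl
+₄-idˡ z3 = refl

+₄-idʳ : ∀ a → a +₄ z0 ≡ a
+₄-idʳ z0 = refl
+₄-idʳ z1 = refl
+₄-idʳ z2 = refl
+₄-idʳ z3 = refl

*₄-idˡ : ∀ a → z1 *₄ a ≡ a
*₄-idˡ z0 = refl
*₄-idˡ z1 = refl
*₄-idˡ z2 = refl
*₄-idˡ z3 = refl

*₄-idʳ : ∀ a → a *₄ z1 ≡ a
*₄-idʳ z0 = refl
*₄-idʳ z1 = refl
*₄-idʳ z2 = refl
*₄-idʳ z3 = refl

-₄-invˡ : ∀ a → (-₄ a) +₄ a ≡ z0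
-₄-invˡ z0 = refl
-₄-invˡ z1 = refl
-₄-invˡ z2 = refl
-₄-invˡ z3 = refl

-₄-invʳ : ∀ a → a +₄ (-₄ a) ≡ z0
-₄-invʳ z0 = refl
-₄-invʳ z1 = refl
-₄-invʳ z2 = refl
-₄-invʳ z3 = refl

ℤ₄ : CommutativeRing _ _
ℤ₄ = record
  { Carrier = Z4 ; _≈_ = _≡_ ; _+_ = _+₄_ ; _*_ = _*₄_ ; -_ = -₄_ ; 0# = z0 ; 1# = z1
  ; isCommutativeRing = record
    { isRing = record
      { +-isAbelianGroup = record
        { isGroup = record
          { isMonoid = record
            { isSemigroup = record
              { isMagma = record { isEquivalence = isEquivalence ; ∙-cong = cong₂ _+₄_ }
              ; assoc = +₄-assoc }
            ; identity = +₄-idˡ , +₄-idʳ }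
          ; inverse = -₄-invˡ , -₄-invʳ
          ; ⁻¹-cong = cong -₄_ }
        ; comm = +₄-comm }
      ; *-cong = cong₂ _*₄_
      ; *-assoc = *₄-assoc
      ; *-identity = *₄-idˡ , *₄-idʳ
      ; distrib = distˡ , distʳ }
    ; *-comm = *₄-comm } }

-- In F × S with F a field, the vertices (a , s) with a ≠ 0 over a fixed
-- zero-divisor s of S form an independent set of size |F*|, since elements of
-- F* never multiply to 0.  Conversely every vertex lies in such a fibre or on
-- the axis a = 0, and an independent set contains no two vertices of kinds that
-- annihilate each other.  In F₁ × F₂ this confines it to one axis; in F × ℤ₄ to
-- the fibres over 0 and 2, or to the fibre over 2 plus (0 , 1) and (0 , 3), or
-- to the three points (0 , z) with z ≠ 0.  Pigeonhole bounds each case.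
module Submission where

open import Defs
open import Algebra.Bundles using (CommutativeRing)
open import Algebra.Construct.DirectProduct using (commutativeRing)

import Level
open import Data.Nat using (ℕ; suc; _≤_; z≤n; s≤s; _≤?_)
import Data.Nat as ℕ
open import Data.Nat.Properties
  using (≤-trans; ≤-refl; ≤-reflexive; m≤m⊔n; m≤n⊔m; ⊔-sel; +-identityʳ; +-monoˡ-≤)
open import Data.Product using (Σ; _×_; _,_; proj₁; proj₂)
open import Data.Sum as Sum using (_⊎_; inj₁; inj₂; [_,_]′)
open import Data.Empty using (⊥; ⊥-elim)
open import Data.List using (List; []; _∷_; length; map; _++_)
open import Data.List.Properties using (length-map; length-++; length-removeAt′)
open import Data.List.Relation.Unary.All as All using (All; []; _∷_)
import Data.List.Relation.Unary.All.Properties as Allₚ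
open import Data.List.Relation.Unary.Any as Any using (here; there; _─_)
import Data.List.Relation.Unary.Any.Properties as Anyₚ
open import Data.List.Relation.Unary.AllPairs as AllPairs using (AllPairs; []; _∷_)
import Data.List.Relation.Unary.AllPairs.Properties as AllPairsₚ
import Data.List.Membership.Setoid as Membership
open import Data.List.Membership.Setoid.Properties using (∈-length)
open import Data.List.Relation.Unary.Unique.Setoid using (Unique)
open import Function using (_∘_; _∘₂_; id)
open import Relation.Nullary using (¬_; Dec; yes; no)
open import Relation.Nullary.Negation using (¬¬-map)
open import Relation.Nullary.Decidable using (decidable-stable; ¬¬-excluded-middle)
open import Relation.Unary using (Pred; _∪_; ∅)
open import Relation.Binary using (Rel; Setoid; Symmetric)
open import Relation.Binary.PropositionalEquality as ≡ using (_≡_; _≢_; refl)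

module _ {a p} {A : Set a} {P : Pred A p} where

  ¬¬-All : ∀ {xs} → All (λ x → ¬ ¬ P x) xs → ¬ ¬ All P xs
  ¬¬-All []             k = k []
  ¬¬-All (¬¬px ∷ ¬¬pxs) k = ¬¬px λ px → ¬¬-All ¬¬pxs λ pxs → k (px ∷ pxs)

  AllPairs-mapWithin : ∀ {r s} {R : Rel A r} {S : Rel A s} →
    (∀ {x y} → P x → P y → R x y → S x y) →
    ∀ {xs} → All P xs → AllPairs R xs → AllPairs S xs
  AllPairs-mapWithin f []         []         = []
  AllPairs-mapWithin f (px ∷ pxs) (rx ∷ rxs) =
    All.zipWith (λ (py , r) → f px py r) (pxs , rx) ∷ AllPairs-mapWithin f pxs rxs

module _ {a r p q} {A : Set a} {R : Rel A r} (R-sym : Symmetric R)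
         {P : Pred A p} {Q : Pred A q} (separated : ∀ {x y} → R x y → P x → Q y → ⊥)
         where

  split : ∀ {n} {N : Pred A n} {xs} →
    AllPairs R xs → All (P ∪ N ∪ Q) xs → All (P ∪ N) xs ⊎ All (N ∪ Q) xs
  split             []         []         = inj₁ []
  split {N = N} {x ∷ _} (rx ∷ rxs) (cx ∷ cxs) with split rxs cxs | cx
  ... | inj₁ pns | inj₁ px        = inj₁ (inj₁ px ∷ pns)
  ... | inj₁ pns | inj₂ (inj₁ nx) = inj₁ (inj₂ nx ∷ pns)
  ... | inj₁ pns | inj₂ (inj₂ qx) = inj₂ (inj₂ qx ∷ All.zipWith away-from-Q (rx , pns))
    where
    away-from-Q : ∀ {y} → R x y × (P ∪ N) y → (N ∪ Q) y
    away-from-Q (r , inj₁ py) = ⊥-elim (separated (R-sym r) py qx)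
    away-from-Q (r , inj₂ ny) = inj₁ ny
  ... | inj₂ nqs | inj₁ px        = inj₁ (inj₁ px ∷ All.zipWith away-from-P (rx , nqs))
    where
    away-from-P : ∀ {y} → R x y × (N ∪ Q) y → (P ∪ N) y
    away-from-P (r , inj₁ ny) = inj₂ ny
    away-from-P (r , inj₂ qy) = ⊥-elim (separated r px qy)
  ... | inj₂ nqs | inj₂ nqx       = inj₂ (nqx ∷ nqs)

  split₂ : ∀ {xs} → AllPairs R xs → All (P ∪ Q) xs → All P xs ⊎ All Q xs
  split₂ rs cs =
    Sum.map (All.map [ id , ⊥-elim ]′) (All.map [ ⊥-elim , id ]′)
            (split {N = ∅} rs (All.map (Sum.map₂ inj₂) cs))

module _ {c ℓ} (S : Setoid c ℓ) where
  open Setoid S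
  open Membership S using (_∈_)

  ∈-─ : ∀ {x y ys} (x∈ys : x ∈ ys) → y ∈ ys → ¬ y ≈ x → y ∈ (ys ─ x∈ys)
  ∈-─ (here x≈z)   (here y≈z)   y≉x = ⊥-elim (y≉x (trans y≈z (sym x≈z)))
  ∈-─ (here _)     (there y∈ys) _   = y∈ys
  ∈-─ (there _)    (here y≈z)   _   = here y≈z
  ∈-─ (there x∈ys) (there y∈ys) y≉x = there (∈-─ x∈ys y∈ys y≉x)

  unique⇒length≤ : ∀ {xs ys} → Unique S xs → All (_∈ ys) xs → length xs ≤ length ys
  unique⇒length≤ []               []               = z≤n
  unique⇒length≤ {ys = ys} (x≉xs ∷ xs!) (x∈ys ∷ xs⊆ys) =
    ≤-trans (s≤s (unique⇒length≤ xs! (All.zipWith in-rest (x≉xs , xs⊆ys))))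
            (≤-reflexive (≡.sym (length-removeAt′ ys (Any.index x∈ys))))
    where
    in-rest : ∀ {y} → ¬ _ ≈ y × y ∈ ys → y ∈ (ys ─ x∈ys)
    in-rest (x≉y , y∈ys) = ∈-─ x∈ys y∈ys (x≉y ∘ sym)

module FieldProperties {c ℓ} (F : CommutativeRing c ℓ) (isField : IsField F) where
  open CommutativeRing F
  open import Relation.Binary.Reasoning.Setoid setoid

  x*y≈0⇒y≈0 : ∀ {x y} → ¬ x ≈ 0# → x * y ≈ 0# → y ≈ 0#
  x*y≈0⇒y≈0 {x} {y} x≉0 xy≈0 with proj₂ isField x x≉0
  ... | x⁻¹ , xx⁻¹≈1 = begin
    y              ≈⟨ sym (*-identityˡ y) ⟩
    1# * y         ≈⟨ *-congʳ (sym xx⁻¹≈1) ⟩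
    (x * x⁻¹) * y  ≈⟨ *-congʳ (*-comm x x⁻¹) ⟩
    (x⁻¹ * x) * y  ≈⟨ *-assoc x⁻¹ x y ⟩
    x⁻¹ * (x * y)  ≈⟨ *-congˡ xy≈0 ⟩
    x⁻¹ * 0#       ≈⟨ zeroʳ x⁻¹ ⟩
    0#             ∎

  x*y≈0⇒x≈0 : ∀ {x y} → ¬ y ≈ 0# → x * y ≈ 0# → x ≈ 0#
  x*y≈0⇒x≈0 {x} {y} y≉0 xy≈0 = x*y≈0⇒y≈0 y≉0 (trans (*-comm y x) xy≈0)

  *-nonzero : ∀ {x y} → ¬ x ≈ 0# → ¬ y ≈ 0# → ¬ x * y ≈ 0#
  *-nonzero x≉0 y≉0 = y≉0 ∘ x*y≈0⇒y≈0 x≉0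

  nonzeroCard⇒1≤ : ∀ {m} → NonzeroCard F m → 1 ≤ m
  nonzeroCard⇒1≤ (_ , _ , _ , covers , refl) = ∈-length setoid (covers 1# (proj₁ isField))

module ZeroDivisorGraph {c ℓ} (R : CommutativeRing c ℓ) where
  open CommutativeRing R
  open Membership setoid using (_∈_)

  Independent : Rel Carrier ℓ
  Independent x y = ¬ x ≈ y × ¬ Adjacent R x y

  independent-sym : Symmetric Independent
  independent-sym (x≉y , x≁y) =
    (x≉y ∘ sym) , λ (y≉x , yx≈0) → x≁y ((y≉x ∘ sym) , trans (*-comm _ _) yx≈0)

  independent⇒*≉0 : ∀ {x y} → Independent x y → ¬ x * y ≈ 0#
  independent⇒*≉0 (x≉y , x≁y) xy≈0 = x≁y (x≉y , xy≈0)

  *≉0⇒independent : ∀ {x y} → ¬ x ≈ y → ¬ x * y ≈ 0# → Independent x y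
  *≉0⇒independent x≉y xy≉0 = x≉y , xy≉0 ∘ proj₂

  covered⇒length≤ : ∀ {p} {Class : Pred Carrier p} {xs} ys → (∀ {x} → Class x → x ∈ ys) →
    AllPairs Independent xs → All Class xs → length xs ≤ length ys
  covered⇒length≤ ys cover ps cs = unique⇒length≤ setoid (AllPairs.map proj₁ ps) (All.map cover cs)

  HasIndependentSetOfSize : ℕ → Set (c Level.⊔ ℓ)
  HasIndependentSetOfSize k = Σ (List Carrier) λ xs → IsIndependentSet R xs × length xs ≡ k

  hasIndependentSetOfSize-⊔ : ∀ {j k} →
    HasIndependentSetOfSize j → HasIndependentSetOfSize k → HasIndependentSetOfSize (j ℕ.⊔ k)
  hasIndependentSetOfSize-⊔ {j} {k} J K with ⊔-sel j k
  ... | inj₁ j⊔k≡j = ≡.subst HasIndependentSetOfSize (≡.sym j⊔k≡j) J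
  ... | inj₂ j⊔k≡k = ≡.subst HasIndependentSetOfSize (≡.sym j⊔k≡k) K

  -- Stability of the decidable goal lets the vertices be classified classically.
  length≤-by-classification : ∀ {p k} {Class : Pred Carrier p} →
    (∀ {x} → IsVertex R x → ¬ ¬ Class x) →
    (∀ {xs} → AllPairs Independent xs → All Class xs → length xs ≤ k) →
    ∀ xs → IsIndependentSet R xs → length xs ≤ k
  length≤-by-classification {k = k} classify bound xs (vs , ps) =
    decidable-stable (length xs ≤? k) (¬¬-map (bound ps) (¬¬-All (All.map classify vs)))

module Image {c ℓ c′ ℓ′} (F : CommutativeRing c ℓ) {m : ℕ} (card : NonzeroCard F m)
             (R : CommutativeRing c′ ℓ′)
             (f : CommutativeRing.Carrier F → CommutativeRing.Carrier R) where
  private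
    module F = CommutativeRing F
    module R = CommutativeRing R
  open ZeroDivisorGraph R
  open Membership R.setoid using (_∈_)

  enumeration : List F.Carrier
  enumeration = proj₁ card

  image : List R.Carrier
  image = map f enumeration

  length-image : length image ≡ m
  length-image = ≡.trans (length-map f enumeration) (proj₂ (proj₂ (proj₂ (proj₂ card))))

  ∈-image : (∀ {a b} → a F.≈ b → f a R.≈ f b) →
    ∀ {a x} → ¬ a F.≈ F.0# → x R.≈ f a → x ∈ image
  ∈-image f-cong {a} a≉0 x≈fa =
    Anyₚ.map⁺ (Any.map (R.trans x≈fa ∘ f-cong) (proj₁ (proj₂ (proj₂ (proj₂ card))) a a≉0))

  image-independent : (∀ {a b} → f a R.≈ f b → a F.≈ b) →
    (∀ {a} → ¬ a F.≈ F.0# → IsVertex R (f a)) →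
    (∀ {a b} → ¬ a F.≈ F.0# → ¬ b F.≈ F.0# → ¬ f a R.* f b R.≈ R.0#) →
    IsIndependentSet R image
  image-independent f-injective vertex f*f≉0 =
    Allₚ.map⁺ (All.map vertex nonzero) ,
    AllPairsₚ.map⁺ (AllPairs-mapWithin
      (λ a≉0 b≉0 a≉b → *≉0⇒independent (a≉b ∘ f-injective) (f*f≉0 a≉0 b≉0))
      nonzero distinct)
    where
    distinct : AllPairs (λ a b → ¬ a F.≈ b) enumeration
    distinct = proj₁ (proj₂ card)
    nonzero : All (λ a → ¬ a F.≈ F.0#) enumeration
    nonzero = proj₁ (proj₂ (proj₂ card))

module Fibre {c₁ ℓ₁ c₂ ℓ₂} (F : CommutativeRing c₁ ℓ₁) (isField : IsField F)
             {m : ℕ} (card : NonzeroCard F m)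
             (S : CommutativeRing c₂ ℓ₂) (s : CommutativeRing.Carrier S) where
  private
    module F = CommutativeRing F
    module S = CommutativeRing S
    F×S : CommutativeRing (c₁ Level.⊔ c₂) (ℓ₁ Level.⊔ ℓ₂)
    F×S = commutativeRing F S
  open FieldProperties F isField
  open Membership (CommutativeRing.setoid F×S) using (_∈_)
  open Image F card F×S (_, s) public

  ∈-fibre : ∀ {a t} → ¬ a F.≈ F.0# → t S.≈ s → (a , t) ∈ image
  ∈-fibre a≉0 t≈s = ∈-image (_, S.refl) a≉0 (F.refl , t≈s)

  fibre-independent : ∀ {s′} → ¬ s′ S.≈ S.0# → s S.* s′ S.≈ S.0# →
    IsIndependentSet F×S image
  fibre-independent {s′} s′≉0 ss′≈0 =
    image-independent proj₁ vertex λ a≉0 b≉0 → *-nonzero a≉0 b≉0 ∘ proj₁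
    where
    vertex : ∀ {a} → ¬ a F.≈ F.0# → IsVertex F×S (a , s)
    vertex {a} a≉0 = a≉0 ∘ proj₁ , (F.0# , s′) , s′≉0 ∘ proj₂ , F.zeroʳ a , ss′≈0

-- Opened only now: the ring modules above use their own _*_ unqualified.
open import Data.Nat using (_+_; _*_; _⊔_)

module ProductOfFields {c₁ ℓ₁ c₂ ℓ₂} (F₁ : CommutativeRing c₁ ℓ₁) (F₂ : CommutativeRing c₂ ℓ₂)
       (isField₁ : IsField F₁) (isField₂ : IsField F₂)
       {m n : ℕ} (card₁ : NonzeroCard F₁ m) (card₂ : NonzeroCard F₂ n) where
  private
    module F₁ = CommutativeRing F₁
    module F₂ = CommutativeRing F₂
    module F₁ᶠ = FieldProperties F₁ isField₁
    module F₂ᶠ = FieldProperties F₂ isField₂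
    F₁×F₂ : CommutativeRing (c₁ Level.⊔ c₂) (ℓ₁ Level.⊔ ℓ₂)
    F₁×F₂ = commutativeRing F₁ F₂
    module P = CommutativeRing F₁×F₂
  open ZeroDivisorGraph F₁×F₂
  open Membership P.setoid using (_∈_)
  module Left = Fibre F₁ isField₁ card₁ F₂ F₂.0#
  module Right = Image F₂ card₂ F₁×F₂ (F₁.0# ,_)

  OnLeftAxis : Pred P.Carrier (ℓ₁ Level.⊔ ℓ₂)
  OnLeftAxis x = ¬ proj₁ x F₁.≈ F₁.0# × proj₂ x F₂.≈ F₂.0#

  OnRightAxis : Pred P.Carrier (ℓ₁ Level.⊔ ℓ₂)
  OnRightAxis x = proj₁ x F₁.≈ F₁.0# × ¬ proj₂ x F₂.≈ F₂.0#

  classify : ∀ {x} → IsVertex F₁×F₂ x → Dec (proj₁ x F₁.≈ F₁.0#) →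
    OnLeftAxis x ⊎ OnRightAxis x
  classify (x≉0 , _) (yes a≈0) = inj₂ (a≈0 , λ b≈0 → x≉0 (a≈0 , b≈0))
  classify (_ , (a′ , b′) , y≉0 , aa′≈0 , bb′≈0) (no a≉0) =
    inj₁ (a≉0 , F₂ᶠ.x*y≈0⇒x≈0 b′≉0 bb′≈0)
    where
    b′≉0 : ¬ b′ F₂.≈ F₂.0#
    b′≉0 b′≈0 = y≉0 (F₁ᶠ.x*y≈0⇒y≈0 a≉0 aa′≈0 , b′≈0)

  left*right≈0 : ∀ {x y} → OnLeftAxis x → OnRightAxis y → x P.* y P.≈ P.0#
  left*right≈0 {a , b} {a′ , b′} (_ , b≈0) (a′≈0 , _) =
    F₁.trans (F₁.*-congˡ a′≈0) (F₁.zeroʳ a) , F₂.trans (F₂.*-congʳ b≈0) (F₂.zeroˡ b′)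

  ∈-left : ∀ {x} → OnLeftAxis x → x ∈ Left.image
  ∈-left (a≉0 , b≈0) = Left.∈-fibre a≉0 b≈0

  ∈-right : ∀ {x} → OnRightAxis x → x ∈ Right.image
  ∈-right (a≈0 , b≉0) = Right.∈-image (F₁.refl ,_) b≉0 (a≈0 , F₂.refl)

  bounded : ∀ {xs} → AllPairs Independent xs → All (OnLeftAxis ∪ OnRightAxis) xs →
    length xs ≤ m ⊔ n
  bounded ps cs with split₂ independent-sym (λ r → independent⇒*≉0 r ∘₂ left*right≈0) ps cs
  ... | inj₁ ls = ≤-trans (covered⇒length≤ Left.image ∈-left ps ls)
                          (≤-trans (≤-reflexive Left.length-image) (m≤m⊔n m n))
  ... | inj₂ rs = ≤-trans (covered⇒length≤ Right.image ∈-right ps rs)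
                          (≤-trans (≤-reflexive Right.length-image) (m≤n⊔m m n))

  right-independent : IsIndependentSet F₁×F₂ Right.image
  right-independent =
    Right.image-independent proj₂ vertex λ a≉0 b≉0 → F₂ᶠ.*-nonzero a≉0 b≉0 ∘ proj₂
    where
    vertex : ∀ {b} → ¬ b F₂.≈ F₂.0# → IsVertex F₁×F₂ (F₁.0# , b)
    vertex {b} b≉0 =
      b≉0 ∘ proj₂ , (F₁.1# , F₂.0#) , proj₁ isField₁ ∘ proj₁ , F₁.zeroˡ F₁.1# , F₂.zeroʳ b

  independenceNumber : IndependenceNumber F₁×F₂ (m ⊔ n)
  independenceNumber =
    hasIndependentSetOfSize-⊔
      (Left.image , Left.fibre-independent (proj₁ isField₂) (F₂.zeroˡ F₂.1#) , Left.length-image)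
      (Right.image , right-independent , Right.length-image) ,
    length≤-by-classification (λ v → ¬¬-map (classify v) ¬¬-excluded-middle) bounded

ℤ₄-zeroDivisor : ∀ t w → t *₄ w ≡ z0 → w ≢ z0 → t ≡ z0 ⊎ t ≡ z2
ℤ₄-zeroDivisor z0 _  _  _   = inj₁ refl
ℤ₄-zeroDivisor z2 _  _  _   = inj₂ refl
ℤ₄-zeroDivisor z1 z0 _  w≢0 = ⊥-elim (w≢0 refl)
ℤ₄-zeroDivisor z3 z0 _  w≢0 = ⊥-elim (w≢0 refl)

2+m≤2m⊔3 : ∀ {m} → 1 ≤ m → 2 + m ≤ 2 * m ⊔ 3
2+m≤2m⊔3 {1}           _ = ≤-refl
2+m≤2m⊔3 {m@(suc (suc _))} _ =
  ≤-trans (+-monoˡ-≤ m (s≤s (s≤s z≤n)))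
          (≤-trans (≤-reflexive (≡.cong (m +_) (≡.sym (+-identityʳ m)))) (m≤m⊔n (2 * m) 3))

module FieldTimesℤ₄ {c ℓ} (F : CommutativeRing c ℓ) (isField : IsField F)
       {m : ℕ} (card : NonzeroCard F m) where
  private
    module F = CommutativeRing F
    module Fᶠ = FieldProperties F isField
    F×ℤ₄ : CommutativeRing c ℓ
    F×ℤ₄ = commutativeRing F ℤ₄
    module P = CommutativeRing F×ℤ₄
  open ZeroDivisorGraph F×ℤ₄
  open Membership P.setoid using (_∈_)
  module Fibre₀ = Fibre F isField card ℤ₄ z0
  module Fibre₂ = Fibre F isField card ℤ₄ z2

  InFibre : Z4 → Pred P.Carrier ℓ
  InFibre z x = ¬ proj₁ x F.≈ F.0# × proj₂ x ≡ z

  OnAxis : Z4 → Pred P.Carrier ℓ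
  OnAxis z x = x P.≈ (F.0# , z)

  OnUnitAxis : Pred P.Carrier ℓ
  OnUnitAxis = OnAxis z1 ∪ OnAxis z3

  Class : Pred P.Carrier ℓ
  Class = InFibre z0 ∪ InFibre z2 ∪ OnUnitAxis ∪ OnAxis z2

  classify : ∀ {x} → IsVertex F×ℤ₄ x → Dec (proj₁ x F.≈ F.0#) → Class x
  classify {_ , z0} (x≉0 , _) (yes a≈0) = ⊥-elim (x≉0 (a≈0 , refl))
  classify {_ , z1} _         (yes a≈0) = inj₂ (inj₂ (inj₁ (inj₁ (a≈0 , refl))))
  classify {_ , z3} _         (yes a≈0) = inj₂ (inj₂ (inj₁ (inj₂ (a≈0 , refl))))
  classify {_ , z2} _         (yes a≈0) = inj₂ (inj₂ (inj₂ (a≈0 , refl)))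
  classify {_ , t} (_ , (_ , w) , y≉0 , ab≈0 , tw≡0) (no a≉0) =
    Sum.map (a≉0 ,_) (inj₁ ∘ (a≉0 ,_))
      (ℤ₄-zeroDivisor t w tw≡0 (λ w≡0 → y≉0 (Fᶠ.x*y≈0⇒y≈0 a≉0 ab≈0 , w≡0)))

  fibre₀*axis≈0 : ∀ {x y} → InFibre z0 x → proj₁ y F.≈ F.0# → x P.* y P.≈ P.0#
  fibre₀*axis≈0 {a , _} {_ , t} (_ , refl) a′≈0 =
    F.trans (F.*-congˡ a′≈0) (F.zeroʳ a) , CommutativeRing.zeroˡ ℤ₄ t

  on-axis : ∀ {y} → (OnUnitAxis ∪ OnAxis z2) y → proj₁ y F.≈ F.0#
  on-axis = [ [ proj₁ , proj₁ ]′ , proj₁ ]′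

  fibre₂*axis₂≈0 : ∀ {x y} → InFibre z2 x → OnAxis z2 y → x P.* y P.≈ P.0#
  fibre₂*axis₂≈0 {a , _} (_ , refl) (a′≈0 , refl) =
    F.trans (F.*-congˡ a′≈0) (F.zeroʳ a) , refl

  fibres : List P.Carrier
  fibres = Fibre₀.image ++ Fibre₂.image

  length-fibres : length fibres ≡ 2 * m
  length-fibres = ≡.trans (length-++ Fibre₀.image)
    (≡.cong₂ _+_ Fibre₀.length-image (≡.trans Fibre₂.length-image (≡.sym (+-identityʳ m))))

  unitAxisPoints : List P.Carrier
  unitAxisPoints = (F.0# , z1) ∷ (F.0# , z3) ∷ []

  axisPoints : List P.Carrier
  axisPoints = unitAxisPoints ++ (F.0# , z2) ∷ []

  unitsAndFibre₂ : List P.Carrier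
  unitsAndFibre₂ = unitAxisPoints ++ Fibre₂.image

  ∈-fibres : ∀ {x} → (InFibre z0 ∪ InFibre z2) x → x ∈ fibres
  ∈-fibres (inj₁ (a≉0 , t≡0)) = Anyₚ.++⁺ˡ (Fibre₀.∈-fibre a≉0 t≡0)
  ∈-fibres (inj₂ (a≉0 , t≡2)) = Anyₚ.++⁺ʳ Fibre₀.image (Fibre₂.∈-fibre a≉0 t≡2)

  ∈-unitAxisPoints : ∀ {x} → OnUnitAxis x → x ∈ unitAxisPoints
  ∈-unitAxisPoints = [ here , there ∘ here ]′

  ∈-unitsAndFibre₂ : ∀ {x} → (InFibre z2 ∪ OnUnitAxis) x → x ∈ unitsAndFibre₂
  ∈-unitsAndFibre₂ (inj₁ (a≉0 , t≡2)) = Anyₚ.++⁺ʳ unitAxisPoints (Fibre₂.∈-fibre a≉0 t≡2)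
  ∈-unitsAndFibre₂ (inj₂ u)           = Anyₚ.++⁺ˡ (∈-unitAxisPoints u)

  ∈-axisPoints : ∀ {x} → (OnUnitAxis ∪ OnAxis z2) x → x ∈ axisPoints
  ∈-axisPoints = [ Anyₚ.++⁺ˡ ∘ ∈-unitAxisPoints , Anyₚ.++⁺ʳ unitAxisPoints ∘ here ]′

  bounded : ∀ {xs} → AllPairs Independent xs → All Class xs → length xs ≤ 2 * m ⊔ 3
  bounded ps cs
    with split independent-sym (λ r p → independent⇒*≉0 r ∘ fibre₀*axis≈0 p ∘ on-axis) ps cs
  ... | inj₁ fs = ≤-trans (covered⇒length≤ fibres ∈-fibres ps fs)
                          (≤-trans (≤-reflexive length-fibres) (m≤m⊔n (2 * m) 3))
  ... | inj₂ rest with split independent-sym (λ r → independent⇒*≉0 r ∘₂ fibre₂*axis₂≈0) ps rest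
  ... | inj₁ fus = ≤-trans (covered⇒length≤ unitsAndFibre₂ ∈-unitsAndFibre₂ ps fus)
                           (≤-trans (≤-reflexive (≡.cong (2 +_) Fibre₂.length-image))
                                    (2+m≤2m⊔3 (Fᶠ.nonzeroCard⇒1≤ card)))
  ... | inj₂ axs = ≤-trans (covered⇒length≤ axisPoints ∈-axisPoints ps axs) (m≤n⊔m (2 * m) 3)

  fibres-independent : IsIndependentSet F×ℤ₄ fibres
  fibres-independent =
    Allₚ.++⁺ (proj₁ fibre₀-independent) (proj₁ fibre₂-independent) ,
    AllPairsₚ.++⁺ (proj₂ fibre₀-independent) (proj₂ fibre₂-independent)
      (Allₚ.map⁺ (All.map (λ a≉0 → Allₚ.map⁺ (All.map (across a≉0) nonzero)) nonzero))
    where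
    fibre₀-independent : IsIndependentSet F×ℤ₄ Fibre₀.image
    fibre₀-independent = Fibre₀.fibre-independent {z1} (λ ()) refl
    fibre₂-independent : IsIndependentSet F×ℤ₄ Fibre₂.image
    fibre₂-independent = Fibre₂.fibre-independent {z2} (λ ()) refl
    nonzero : All (λ a → ¬ a F.≈ F.0#) Fibre₀.enumeration
    nonzero = proj₁ (proj₂ (proj₂ card))
    across : ∀ {a b} → ¬ a F.≈ F.0# → ¬ b F.≈ F.0# → Independent (a , z0) (b , z2)
    across a≉0 b≉0 = (λ ()) ∘ proj₂ , Fᶠ.*-nonzero a≉0 b≉0 ∘ proj₁ ∘ proj₂

  axisPoints-independent : IsIndependentSet F×ℤ₄ axisPoints
  axisPoints-independent =
    (vertex (λ ()) ∷ vertex (λ ()) ∷ vertex (λ ()) ∷ []) ,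
    (independent (λ ()) (λ ()) ∷ independent (λ ()) (λ ()) ∷ []) ∷
    (independent (λ ()) (λ ()) ∷ []) ∷ [] ∷ []
    where
    vertex : ∀ {z} → z ≢ z0 → IsVertex F×ℤ₄ (F.0# , z)
    vertex {z} z≢0 =
      z≢0 ∘ proj₂ , (F.1# , z0) , proj₁ isField ∘ proj₁ , F.zeroˡ F.1# , CommutativeRing.zeroʳ ℤ₄ z
    independent : ∀ {z z′} → z ≢ z′ → z *₄ z′ ≢ z0 → Independent (F.0# , z) (F.0# , z′)
    independent z≢z′ zz′≢0 = z≢z′ ∘ proj₂ , zz′≢0 ∘ proj₂ ∘ proj₂

  independenceNumber : IndependenceNumber F×ℤ₄ (2 * m ⊔ 3)
  independenceNumber =
    hasIndependentSetOfSize-⊔ (fibres , fibres-independent , length-fibres)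
                              (axisPoints , axisPoints-independent , refl) ,
    length≤-by-classification (λ v → ¬¬-map (classify v) ¬¬-excluded-middle) bounded

corollary2 : ∀ {c₁ ℓ₁ c₂ ℓ₂} (F₁ : CommutativeRing c₁ ℓ₁) (F₂ : CommutativeRing c₂ ℓ₂)
    (m n : ℕ) → IsField F₁ → IsField F₂ → NonzeroCard F₁ m → NonzeroCard F₂ n →
    IndependenceNumber (commutativeRing F₁ F₂) (m ⊔ n) ×
    IndependenceNumber (commutativeRing F₁ ℤ₄) ((2 * m) ⊔ 3)
corollary2 F₁ F₂ m n isField₁ isField₂ card₁ card₂ =
  ProductOfFields.independenceNumber F₁ F₂ isField₁ isField₂ card₁ card₂ ,
  FieldTimesℤ₄.independenceNumber F₁ isField₁ card₁
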